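{- Let $\mathcal T_1$ be a CTS. For every CTS $\mathcal T$ and every reachable state $(s_1,s)$ of $\mathcal T_1\|\mathcal T$: if $(s_1,(\upsilon,!,\star),s_1')\in R_1$, then there exists $s'$ such that $((s_1,s),(\upsilon,!,\star),(s_1',s'))\in R_{\mathcal T_1\|\mathcal T}$.
   Context: A channelled transition system (CTS) is $\mathcal T=\langle C,\Sigma,\Upsilon,S,S_0,R,L,ls\rangle$: $C$ a set of channels including a broadcast channel $\star$; $\Upsilon=\Upsilon^+\times\{!,?\}\times C$; $S$ states; $S_0\subseteq S$ initial; $R\subseteq S\times\Upsilon\times S$; $L:S\to\Sigma$; $ls:S\to 2^C$ with $\star\in ls(s)$ for every $s$. The composition $\mathcal T_1\|\mathcal T_2$ has channels $C_1\cup C_2$, states $S_1\times S_2$, initial states $S_0^1\times S_0^2$, $ls(s_1,s_2)=ls^1(s_1)\cup ls^2(s_2)$, componentwise labels, and transition relation $R$ the union of: (a) $((s_1,s_2),(\upsilon,!,c),(s_1',s_2'))$ such that [$(s_1,(\upsilon,!,c),s_1')\in R_1$ and $(s_2,(\upsilon,?,c),s_2')\in R_2$] or [$(s_1,(\upsilon,?,c),s_1')\in R_1$ and $(s_2,(\upsilon,!,c),s_2')\in R_2$] or [$(s_1,(\upsilon,!,c),s_1')\in R_1$, $c\notin ls^2(s_2)$, $s_2=s_2'$] or [$c\notin ls^1(s_1)$, $s_1=s_1'$, $(s_2,(\upsilon,!,c),s_2')\in R_2$]; (b) $((s_1,s_2),(\upsilon,?,c),(s_1',s_2'))$ such that both components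 make $(\upsilon,?,c)$, or one makes $(\upsilon,?,c)$ while the other has $c\notin ls$ and stays; (c) $((s_1,s_2),(\upsilon,\gamma,\star),(s_1',s_2'))$, $\gamma\in\{!,?\}$, such that [$(s_1,(\upsilon,\gamma,\star),s_1')\in R_1$, $s_2=s_2'$, and no $(s_2,(\upsilon,?,\star),s_2'')\in R_2$] or symmetrically with roles of components 1 and 2 swapped. A state is reachable if it is reached from an initial state by a finite sequence of transitions. -}

module Defs where

open import Data.Product using (Σ; _×_; _,_; proj₁; proj₂; ∃-syntax)
open import Data.Sum using (_⊎_; inj₁; inj₂)
open import Relation.Nullary using (¬_)

-- Directions: snd = '!', rcv = '?'
data Dir : Set where
  snd rcv : Dir

-- A fixed global universe of values (Υ⁺) and of channel names, containing the
-- broadcast channel ★.  Each CTS selects its channel set C as a subset.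
module CTSDefs (Val : Set) (Chan : Set) (★ : Chan) where

  -- Υ⁺ × {!,?} × Chan ; membership of the channel in C is a CTS-level axiom
  Act : Set
  Act = Val × Dir × Chan

  chanOf : Act → Chan
  chanOf (_ , _ , c) = c

  record CTS : Set₁ where
    field
      C      : Chan → Set
      ★∈C    : C ★
      Lab    : Set
      S      : Set
      S₀     : S → Set
      R      : S → Act → S → Set
      R-chan : ∀ {s a s'} → R s a s' → C (chanOf a)
      L      : S → Lab
      ls     : S → Chan → Set
      ls⊆C   : ∀ {s c} → ls s c → C c
      ★∈ls   : ∀ s → ls s ★

  module Comp (T₁ T₂ : CTS) where
    open CTS T₁ renaming (S to S₁; R to R₁; ls to ls₁; C to C₁; R-chan to R-chan₁; ls⊆C to ls⊆C₁)
    open CTS T₂ renaming (S to S₂; R to R₂; ls to ls₂; C to C₂; R-chan to R-chan₂; ls⊆C to ls⊆C₂)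

    data CR : S₁ × S₂ → Act → S₁ × S₂ → Set where
      a-sr : ∀ {s₁ s₁' s₂ s₂' υ c} → R₁ s₁ (υ , snd , c) s₁' → R₂ s₂ (υ , rcv , c) s₂'
           → CR (s₁ , s₂) (υ , snd , c) (s₁' , s₂')
      a-rs : ∀ {s₁ s₁' s₂ s₂' υ c} → R₁ s₁ (υ , rcv , c) s₁' → R₂ s₂ (υ , snd , c) s₂'
           → CR (s₁ , s₂) (υ , snd , c) (s₁' , s₂')
      a-s₁ : ∀ {s₁ s₁' s₂ υ c} → R₁ s₁ (υ , snd , c) s₁' → ¬ ls₂ s₂ c
           → CR (s₁ , s₂) (υ , snd , c) (s₁' , s₂)
      a-s₂ : ∀ {s₁ s₂ s₂' υ c} → ¬ ls₁ s₁ c → R₂ s₂ (υ , snd , c) s₂'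
           → CR (s₁ , s₂) (υ , snd , c) (s₁ , s₂')
      b-rr : ∀ {s₁ s₁' s₂ s₂' υ c} → R₁ s₁ (υ , rcv , c) s₁' → R₂ s₂ (υ , rcv , c) s₂'
           → CR (s₁ , s₂) (υ , rcv , c) (s₁' , s₂')
      b-r₁ : ∀ {s₁ s₁' s₂ υ c} → R₁ s₁ (υ , rcv , c) s₁' → ¬ ls₂ s₂ c
           → CR (s₁ , s₂) (υ , rcv , c) (s₁' , s₂)
      b-r₂ : ∀ {s₁ s₂ s₂' υ c} → ¬ ls₁ s₁ c → R₂ s₂ (υ , rcv , c) s₂'
           → CR (s₁ , s₂) (υ , rcv , c) (s₁ , s₂')
      c-₁ : ∀ {s₁ s₁' s₂ υ γ} → R₁ s₁ (υ , γ , ★) s₁'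
          → (∀ s₂'' → ¬ R₂ s₂ (υ , rcv , ★) s₂'')
          → CR (s₁ , s₂) (υ , γ , ★) (s₁' , s₂)
      c-₂ : ∀ {s₁ s₂ s₂' υ γ} → R₂ s₂ (υ , γ , ★) s₂'
          → (∀ s₁'' → ¬ R₁ s₁ (υ , rcv , ★) s₁'')
          → CR (s₁ , s₂) (υ , γ , ★) (s₁ , s₂')

    CR-chan : ∀ {s a s'} → CR s a s' → C₁ (chanOf a) ⊎ C₂ (chanOf a)
    CR-chan (a-sr r _) = inj₁ (R-chan₁ r)
    CR-chan (a-rs r _) = inj₁ (R-chan₁ r)
    CR-chan (a-s₁ r _) = inj₁ (R-chan₁ r)
    CR-chan (a-s₂ _ r) = inj₂ (R-chan₂ r)
    CR-chan (b-rr r _) = inj₁ (R-chan₁ r)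
    CR-chan (b-r₁ r _) = inj₁ (R-chan₁ r)
    CR-chan (b-r₂ _ r) = inj₂ (R-chan₂ r)
    CR-chan (c-₁ r _) = inj₁ (R-chan₁ r)
    CR-chan (c-₂ r _) = inj₂ (R-chan₂ r)

    ls⊆C-comp : ∀ {s c} → (ls₁ (proj₁ s) c ⊎ ls₂ (proj₂ s) c) → C₁ c ⊎ C₂ c
    ls⊆C-comp (inj₁ x) = inj₁ (ls⊆C₁ x)
    ls⊆C-comp (inj₂ y) = inj₂ (ls⊆C₂ y)

  _∥_ : CTS → CTS → CTS
  T₁ ∥ T₂ = record
    { C      = λ c → CTS.C T₁ c ⊎ CTS.C T₂ c
    ; ★∈C    = inj₁ (CTS.★∈C T₁)
    ; Lab    = CTS.Lab T₁ × CTS.Lab T₂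
    ; S      = CTS.S T₁ × CTS.S T₂
    ; S₀     = λ s → CTS.S₀ T₁ (proj₁ s) × CTS.S₀ T₂ (proj₂ s)
    ; R      = Comp.CR T₁ T₂
    ; R-chan = Comp.CR-chan T₁ T₂
    ; L      = λ s → CTS.L T₁ (proj₁ s) , CTS.L T₂ (proj₂ s)
    ; ls     = λ s c → CTS.ls T₁ (proj₁ s) c ⊎ CTS.ls T₂ (proj₂ s) c
    ; ls⊆C   = λ {s} → Comp.ls⊆C-comp T₁ T₂ {s}
    ; ★∈ls   = λ s → inj₁ (CTS.★∈ls T₁ (proj₁ s))
    }

  data Reachable (T : CTS) : CTS.S T → Set where
    init : ∀ {s} → CTS.S₀ T s → Reachable T s
    step : ∀ {s a s'} → Reachable T s → CTS.R T s a s' → Reachable T s'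

-- Either the partner can receive the broadcast, and the two synchronise
-- (rule (a)), or it cannot, and the sender moves alone (rule (c)). Deciding
-- which case holds is the only use of excluded middle.
module Submission where

open import Defs
open import Data.Product using (_,_; ∃-syntax)
open import Level using (0ℓ)
open import Axiom.ExcludedMiddle using (ExcludedMiddle)
open import Relation.Nullary using (yes; no)

module _ (Val Chan : Set) (★ : Chan) where
  open CTSDefs Val Chan ★

  broadcast-send-enabled : ExcludedMiddle 0ℓ → (T₁ T₂ : CTS)
    {s₁ s₁' : CTS.S T₁} (s₂ : CTS.S T₂) {υ : Val} →
    CTS.R T₁ s₁ (υ , snd , ★) s₁' →
    ∃[ s₂' ] CTS.R (T₁ ∥ T₂) (s₁ , s₂) (υ , snd , ★) (s₁' , s₂')
  broadcast-send-enabled em T₁ T₂ s₂ {υ} send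
    with em {∃[ s₂' ] CTS.R T₂ s₂ (υ , rcv , ★) s₂'}
  ... | yes (s₂' , receive) = s₂' , Comp.a-sr send receive
  ... | no ¬receive         = s₂ , Comp.c-₁ send (λ s₂' receive → ¬receive (s₂' , receive))

mainTheorem9 : ExcludedMiddle 0ℓ →
    (Val Chan : Set) (★ : Chan) →
    let open CTSDefs Val Chan ★ in
    (T₁ : CTS) (T : CTS) →
    (s₁ : CTS.S T₁) (s : CTS.S T) →
    Reachable (T₁ ∥ T) (s₁ , s) →
    (υ : Val) (s₁' : CTS.S T₁) →
    CTS.R T₁ s₁ (υ , snd , ★) s₁' →
    ∃[ s' ] CTS.R (T₁ ∥ T) (s₁ , s) (υ , snd , ★) (s₁' , s')
mainTheorem9 em Val Chan ★ T₁ T s₁ s _ υ s₁' send =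
  broadcast-send-enabled Val Chan ★ em T₁ T s send
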